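{- Let $p$ be an odd prime. Then for any $k\in\{1,\ldots,p-1\}$, $$k\binom{2k}k\binom{2(p-k)}{p-k}\equiv(-1)^{\lfloor 2k/p\rfloor-1}\,2p\pmod{p^2}.$$ -}

module Defs where

open import Data.Nat using (ℕ; zero; suc)
open import Data.Integer using (ℤ; +_; -[1+_]; -_)

negOnePowℕ : ℕ → ℤ
negOnePowℕ zero = + 1
negOnePowℕ (suc n) = - negOnePowℕ n

-- (-1)^e for an integer exponent e (well defined since (-1)^{-1} = -1):
-- (-1)^(-(m+1)) = (-1)^(m+1)
negOnePow : ℤ → ℤ
negOnePow (+ n) = negOnePowℕ n
negOnePow -[1+ m ] = negOnePowℕ (suc m)

-- For a prime p and 1 ≤ k < p put m = p − k; the claim says
-- k·C(2k,k)·C(2m,m) ≡ −2p (mod p²) when 2k < p, and ≡ +2p when 2k ≥ p.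
--
-- "−" case (k ≤ m, m = k + r, 2m = p + r).  Since (2m)! = p·Q with
-- Q ≡ (p−1)!·r!, we get C(2m,m) = c·p with c·(m!)² ≡ (p−1)!·r! (mod p).
-- The reflection congruence (p−1)! ≡ (−1)^a·a!·(p−1−a)! at a = k−1 and at
-- a = 2k−1, together with (k!)²·C(2k,k) = 2k·(2k−1)!, shows that a product of
-- factorials below p annihilates k·C(2k,k)·c + 2 mod p; as p is prime,
-- p ∣ k·C(2k,k)·c + 2, and multiplying by p gives the claim.
-- "+" case (m ≤ k): apply the "−" case to m, and use that
-- k·C_k·C_m + m·C_m·C_k = p·C_k·C_m ≡ 0 (mod p²) because p ∣ C(2k,k).
module Submission where

open import Defs
open import Data.Nat using (ℕ; _≤_; _<_; _/_; _∸_; NonZero)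
open import Data.Nat.Primality using (Prime)
open import Data.Nat.Combinatorics using (_C_)
open import Data.Integer using (ℤ; +_; _-_)
open import Data.Integer.Divisibility using (_∣_)
open import Relation.Binary.PropositionalEquality using (_≢_)
import Data.Nat as ℕ
import Data.Integer as ℤ

open import Data.Nat using (zero; suc; _!; s≤s)
import Data.Nat.Properties as ℕP
import Data.Nat.Divisibility as ℕD
open import Data.Nat.DivMod using (m<n⇒m/n≡0; m/n≡1+[m∸n]/n; m*[n/m]≡n)
open import Data.Nat.Primality using (euclidsLemma; ¬prime[0]; ¬prime[1])
open import Data.Nat.Combinatorics using (k![n∸k]!∣n!)
open import Data.Nat.Combinatorics.Specification using (nCk≡n!/k![n-k]!)
open import Data.Nat.Tactic.RingSolver as ℕSolver using ()
open import Data.Integer using (-_; _+_; _*_; 0ℤ; 1ℤ; -1ℤ)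
import Data.Integer.Properties as ℤP
open import Data.Integer.Divisibility.Signed as ℤD using (divides; ∣⇒∣ᵤ)
  renaming (_∣_ to _∣ℤ_)
open import Data.Integer.Tactic.RingSolver using (solve-∀)
open import Data.Product using (Σ; _×_; _,_)
open import Data.Sum using (_⊎_; inj₁; inj₂)
open import Relation.Nullary using (¬_; yes; no; contradiction)
open import Relation.Binary.Bundles using (Setoid)
import Relation.Binary.Reasoning.Setoid
open import Relation.Binary.PropositionalEquality
  using (_≡_; refl; sym; trans; cong; cong₂; subst; module ≡-Reasoning)

module Congruence (n : ℤ) where

  infix 4 _≈_
  record _≈_ (a b : ℤ) : Set where
    constructor mod
    field divides-difference : n ∣ℤ a - b

  ≡⇒≈ : ∀ {a b} → a ≡ b → a ≈ b
  ≡⇒≈ {a} refl = mod (divides 0ℤ (trans (ℤP.+-inverseʳ a) (sym (ℤP.*-zeroˡ n))))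

  ≈-sym : ∀ {a b} → a ≈ b → b ≈ a
  ≈-sym {a} {b} (mod d) = mod (subst (n ∣ℤ_) (swap a b) (ℤD.∣m⇒∣-m d))
    where
    swap : ∀ a b → - (a - b) ≡ b - a
    swap = solve-∀

  ≈-trans : ∀ {a b c} → a ≈ b → b ≈ c → a ≈ c
  ≈-trans {a} {b} {c} (mod d) (mod e) = mod (subst (n ∣ℤ_) (telescope a b c) (ℤD.∣m∣n⇒∣m+n d e))
    where
    telescope : ∀ a b c → (a - b) + (b - c) ≡ a - c
    telescope = solve-∀

  setoid : Setoid _ _
  setoid = record
    { Carrier = ℤ
    ; _≈_ = _≈_
    ; isEquivalence = record { refl = ≡⇒≈ refl ; sym = ≈-sym ; trans = ≈-trans }
    }

  +-cong : ∀ {a b c d} → a ≈ b → c ≈ d → a + c ≈ b + d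
  +-cong {a} {b} {c} {d} (mod x) (mod y) = mod (subst (n ∣ℤ_) (regroup a b c d) (ℤD.∣m∣n⇒∣m+n x y))
    where
    regroup : ∀ a b c d → (a - b) + (c - d) ≡ (a + c) - (b + d)
    regroup = solve-∀

  *-cong : ∀ {a b c d} → a ≈ b → c ≈ d → a * c ≈ b * d
  *-cong {a} {b} {c} {d} (mod x) (mod y) =
    mod (subst (n ∣ℤ_) (regroup a b c d) (ℤD.∣m∣n⇒∣m+n (ℤD.∣n⇒∣m*n c x) (ℤD.∣n⇒∣m*n b y)))
    where
    regroup : ∀ a b c d → c * (a - b) + b * (c - d) ≡ a * c - b * d
    regroup = solve-∀

  *-congˡ : ∀ c {a b} → a ≈ b → c * a ≈ c * b
  *-congˡ c = *-cong (≡⇒≈ {c} refl)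

  *-congʳ : ∀ c {a b} → a ≈ b → a * c ≈ b * c
  *-congʳ c a≈b = *-cong a≈b (≡⇒≈ {c} refl)

  -‿cong : ∀ {a b} → a ≈ b → - a ≈ - b
  -‿cong {a} {b} (mod x) = mod (subst (n ∣ℤ_) (negate a b) (ℤD.∣m⇒∣-m x))
    where
    negate : ∀ a b → - (a - b) ≡ - a - - b
    negate = solve-∀

  ≈0⇒∣ : ∀ {a} → a ≈ 0ℤ → n ∣ℤ a
  ≈0⇒∣ {a} (mod d) = subst (n ∣ℤ_) (ℤP.+-identityʳ a) d

  module ≈-Reasoning = Relation.Binary.Reasoning.Setoid setoid

sign : ℕ → ℤ
sign = negOnePowℕ

sign-square : ∀ a → sign a * sign a ≡ 1ℤ
sign-square zero = refl
sign-square (suc a) = trans (negated-square (sign a)) (sign-square a)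
  where
  negated-square : ∀ x → (- x) * (- x) ≡ x * x
  negated-square = solve-∀

sign-even : ∀ a → sign (a ℕ.+ a) ≡ 1ℤ
sign-even zero = refl
sign-even (suc a) = begin
  sign (suc a ℕ.+ suc a)     ≡⟨ cong (λ e → - sign e) (ℕP.+-suc a a) ⟩
  - - sign (a ℕ.+ a)         ≡⟨ ℤP.neg-involutive _ ⟩
  sign (a ℕ.+ a)             ≡⟨ sign-even a ⟩
  1ℤ                         ∎
  where open ≡-Reasoning

fac : ℕ → ℤ
fac n = + (n !)

fac-suc : ∀ n → fac (suc n) ≡ + suc n * fac n
fac-suc n = ℤP.pos-* (suc n) (n !)

double∸self : ∀ n → 2 ℕ.* n ∸ n ≡ n
double∸self n = trans (ℕP.m+n∸m≡n n (n ℕ.+ 0)) (ℕP.+-identityʳ n)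

binomial-factorials : ∀ {n k} → k ≤ n → k ! ℕ.* (n ∸ k) ! ℕ.* (n C k) ≡ n !
binomial-factorials {n} {k} k≤n =
  trans (cong (k ! ℕ.* (n ∸ k) ! ℕ.*_) (nCk≡n!/k![n-k]! k≤n))
        (m*[n/m]≡n {{ℕP._!*_!≢0 k (n ∸ k)}} (k![n∸k]!∣n! k≤n))

central-binomial : ∀ n → fac n * fac n * + ((2 ℕ.* n) C n) ≡ fac (2 ℕ.* n)
central-binomial n = begin
  fac n * fac n * + Cn                 ≡⟨ cong (_* + Cn) (ℤP.pos-* (n !) (n !)) ⟨
  + (n ! ℕ.* n !) * + Cn               ≡⟨ ℤP.pos-* (n ! ℕ.* n !) Cn ⟨
  + (n ! ℕ.* n ! ℕ.* Cn)             ≡⟨ cong (λ e → + (n ! ℕ.* e ! ℕ.* Cn)) (double∸self n) ⟨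
  + (n ! ℕ.* (2 ℕ.* n ∸ n) ! ℕ.* Cn)   ≡⟨ cong +_ (binomial-factorials (ℕP.m≤m+n n (n ℕ.+ 0))) ⟩
  fac (2 ℕ.* n)                       ∎
  where
  open ≡-Reasoning
  Cn = (2 ℕ.* n) C n

central-binomial-step : ∀ i →
  + ((2 ℕ.* suc i) C suc i) * fac (suc i) * fac (suc i) ≡ + 2 * + suc i * fac (suc (i ℕ.+ i))
central-binomial-step i = begin
  + Ck * K * K                     ≡⟨ rotate (+ Ck) K ⟩
  K * K * + Ck                     ≡⟨ central-binomial (suc i) ⟩
  fac (2 ℕ.* suc i)                ≡⟨ cong fac (double-suc i) ⟩
  fac (suc (suc (i ℕ.+ i)))        ≡⟨ fac-suc (suc (i ℕ.+ i)) ⟩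
  + suc (suc (i ℕ.+ i)) * G        ≡⟨ cong (λ e → + e * G) (double-suc i) ⟨
  + (2 ℕ.* suc i) * G              ≡⟨ cong (_* G) (ℤP.pos-* 2 (suc i)) ⟩
  + 2 * + suc i * G                ∎
  where
  open ≡-Reasoning
  Ck = (2 ℕ.* suc i) C suc i
  K = fac (suc i)
  G = fac (suc (i ℕ.+ i))
  rotate : ∀ x y → x * y * y ≡ y * y * x
  rotate = solve-∀
  double-suc : ∀ i → 2 ℕ.* suc i ≡ suc (suc (i ℕ.+ i))
  double-suc = ℕSolver.solve-∀

module FactorialsModulo (q : ℕ) where

  p : ℕ
  p = suc q

  open Congruence (+ p)

  complement : ∀ x y → x ℕ.+ y ≡ p → + y ≈ - + x
  complement x y x+y≡p = mod (divides 1ℤ (begin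
    + y - - + x   ≡⟨ flip (+ x) (+ y) ⟩
    + x + + y     ≡⟨ ℤP.pos-+ x y ⟨
    + (x ℕ.+ y)   ≡⟨ cong +_ x+y≡p ⟩
    + p           ≡⟨ ℤP.*-identityˡ (+ p) ⟨
    1ℤ * + p      ∎))
    where
    open ≡-Reasoning
    flip : ∀ x y → y - - x ≡ x + y
    flip = solve-∀

  -- Reflection: (p−1)! ≡ (−1)^a · a! · b!  whenever a + b = p − 1, because
  -- (p−1)(p−2)⋯(p−a) ≡ (−1)^a · a!.
  reflection : ∀ a b → a ℕ.+ b ≡ q → fac q ≈ sign a * fac a * fac b
  reflection zero b b≡q = ≡⇒≈ (trans (cong fac (sym b≡q)) (sym (ℤP.*-identityˡ (fac b))))
  reflection (suc a) b a+b≡q = begin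
    fac q                                   ≈⟨ reflection a (suc b) (trans (ℕP.+-suc a b) a+b≡q) ⟩
    sign a * fac a * fac (suc b)            ≡⟨ cong (sign a * fac a *_) (fac-suc b) ⟩
    sign a * fac a * (+ suc b * fac b)      ≈⟨ *-congˡ (sign a * fac a) (*-congʳ (fac b) step) ⟩
    sign a * fac a * (- + suc a * fac b)    ≡⟨ regroup (sign a) (fac a) (+ suc a) (fac b) ⟩
    - sign a * (+ suc a * fac a) * fac b    ≡⟨ cong (λ e → - sign a * e * fac b) (fac-suc a) ⟨
    sign (suc a) * fac (suc a) * fac b      ∎
    where
    open ≈-Reasoning
    step : + suc b ≈ - + suc a
    step = complement (suc a) (suc b) (cong suc (trans (ℕP.+-suc a b) a+b≡q))
    regroup : ∀ s f x g → s * f * (- x * g) ≡ - s * (x * f) * g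
    regroup = solve-∀

  -- Beyond p: (p + r)! = p · Q with Q ≡ (p−1)! · r!  (mod p), since the
  -- factors p + i with 1 ≤ i ≤ r are congruent to i.
  beyond : ∀ r → Σ ℤ λ Q → fac (p ℕ.+ r) ≡ + p * Q × Q ≈ fac q * fac r
  beyond zero = fac q , trans (cong fac (ℕP.+-identityʳ p)) (fac-suc q) , ≡⇒≈ (sym (ℤP.*-identityʳ (fac q)))
  beyond (suc r) with beyond r
  ... | Q , split , Q≈ = + suc (p ℕ.+ r) * Q , split′ , Q′≈
    where
    split′ : fac (p ℕ.+ suc r) ≡ + p * (+ suc (p ℕ.+ r) * Q)
    split′ = begin
      fac (p ℕ.+ suc r)               ≡⟨ cong fac (ℕP.+-suc p r) ⟩
      fac (suc (p ℕ.+ r))             ≡⟨ fac-suc (p ℕ.+ r) ⟩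
      + suc (p ℕ.+ r) * fac (p ℕ.+ r) ≡⟨ cong (+ suc (p ℕ.+ r) *_) split ⟩
      + suc (p ℕ.+ r) * (+ p * Q)     ≡⟨ swap (+ suc (p ℕ.+ r)) (+ p) Q ⟩
      + p * (+ suc (p ℕ.+ r) * Q)     ∎
      where
      open ≡-Reasoning
      swap : ∀ x y z → x * (y * z) ≡ y * (x * z)
      swap = solve-∀
    shift : + suc (p ℕ.+ r) ≈ + suc r
    shift = mod (divides 1ℤ (begin
      + suc (p ℕ.+ r) - + suc r       ≡⟨ cong (λ e → + e - + suc r) (ℕP.+-suc p r) ⟨
      + (p ℕ.+ suc r) - + suc r       ≡⟨ cong (_- + suc r) (ℤP.pos-+ p (suc r)) ⟩
      + p + + suc r - + suc r         ≡⟨ cancel (+ p) (+ suc r) ⟩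
      1ℤ * + p                        ∎))
      where
      open ≡-Reasoning
      cancel : ∀ x y → x + y - y ≡ 1ℤ * x
      cancel = solve-∀
    Q′≈ : + suc (p ℕ.+ r) * Q ≈ fac q * fac (suc r)
    Q′≈ = begin
      + suc (p ℕ.+ r) * Q             ≈⟨ *-cong shift Q≈ ⟩
      + suc r * (fac q * fac r)       ≡⟨ swap (+ suc r) (fac q) (fac r) ⟩
      fac q * (+ suc r * fac r)       ≡⟨ cong (fac q *_) (fac-suc r) ⟨
      fac q * fac (suc r)             ∎
      where
      open ≈-Reasoning
      swap : ∀ x y z → x * (y * z) ≡ y * (x * z)
      swap = solve-∀

  -- Squaring removes the sign in the reflection congruence.
  squared-reflection : ∀ a b → a ℕ.+ b ≡ q → fac q * fac q ≈ (fac a * fac b) * (fac a * fac b)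
  squared-reflection a b a+b≡q = begin
    fac q * fac q                       ≈⟨ *-cong W≈ W≈ ⟩
    sign a * X * (sign a * X)           ≡⟨ regroup (sign a) X ⟩
    sign a * sign a * (X * X)           ≡⟨ cong (_* (X * X)) (sign-square a) ⟩
    1ℤ * (X * X)                        ≡⟨ ℤP.*-identityˡ (X * X) ⟩
    X * X                               ∎
    where
    open ≈-Reasoning
    X = fac a * fac b
    W≈ : fac q ≈ sign a * X
    W≈ = ≈-trans (reflection a b a+b≡q) (≡⇒≈ (ℤP.*-assoc (sign a) (fac a) (fac b)))
    regroup : ∀ s x → s * x * (s * x) ≡ s * s * (x * x)
    regroup = solve-∀

  odd-reflection : ∀ i b → suc (i ℕ.+ i) ℕ.+ b ≡ q → fac b * fac (suc (i ℕ.+ i)) ≈ - fac q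
  odd-reflection i b a+b≡q = begin
    fac b * G                         ≡⟨ regroup (fac b) G ⟩
    - (- 1ℤ * G * fac b)              ≡⟨ cong (λ s → - (- s * G * fac b)) (sign-even i) ⟨
    - (sign (suc (i ℕ.+ i)) * G * fac b) ≈⟨ -‿cong (≈-sym (reflection (suc (i ℕ.+ i)) b a+b≡q)) ⟩
    - fac q                           ∎
    where
    open ≈-Reasoning
    G = fac (suc (i ℕ.+ i))
    regroup : ∀ x y → x * y ≡ - (- 1ℤ * y * x)
    regroup = solve-∀

module _ (n : ℤ) where
  open Congruence n

  annihilator : ∀ k B c M J K G W R → K ≡ k * J → B * K * K ≡ + 2 * k * G →
    c * (M * M) ≈ W * R → W * W ≈ (J * M) * (J * M) → R * G ≈ - W →
    M * M * J * K * G * (k * B * c + + 2) ≈ 0ℤ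
  annihilator k B c M J .(k * J) G W R refl BK²≡2kG cM²≈WR W²≈J²M² RG≈-W = begin
    M * M * J * (k * J) * G * (k * B * c + + 2)
      ≡⟨ expand k B c M J G ⟩
    c * (M * M) * (B * (k * J) * (k * J)) * G + + 2 * k * G * ((J * M) * (J * M))
      ≈⟨ +-cong (*-congʳ G (*-cong cM²≈WR (≡⇒≈ BK²≡2kG))) (*-congˡ (+ 2 * k * G) (≈-sym W²≈J²M²)) ⟩
    W * R * (+ 2 * k * G) * G + + 2 * k * G * (W * W)
      ≡⟨ regroup k G W R ⟩
    + 2 * k * G * W * (R * G) + + 2 * k * G * (W * W)
      ≈⟨ +-cong (*-congˡ (+ 2 * k * G * W) RG≈-W) (≡⇒≈ refl) ⟩
    + 2 * k * G * W * (- W) + + 2 * k * G * (W * W)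
      ≡⟨ cancel k G W ⟩
    0ℤ ∎
    where
    open ≈-Reasoning
    expand : ∀ k B c M J G → M * M * J * (k * J) * G * (k * B * c + + 2)
           ≡ c * (M * M) * (B * (k * J) * (k * J)) * G + + 2 * k * G * ((J * M) * (J * M))
    expand = solve-∀
    regroup : ∀ k G W R → W * R * (+ 2 * k * G) * G + + 2 * k * G * (W * W)
            ≡ + 2 * k * G * W * (R * G) + + 2 * k * G * (W * W)
    regroup = solve-∀
    cancel : ∀ k G W → + 2 * k * G * W * (- W) + + 2 * k * G * (W * W) ≡ 0ℤ
    cancel = solve-∀

prime∤factorial : ∀ {p n} → Prime p → n < p → ¬ (p ℕD.∣ n !)
prime∤factorial {n = zero} p-prime _ p∣1 = ¬prime[1] (subst Prime (ℕD.∣1⇒≡1 p∣1) p-prime)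
prime∤factorial {n = suc n} p-prime n<p p∣n! with euclidsLemma (suc n) (n !) p-prime p∣n!
... | inj₁ p∣n = ℕP.<⇒≱ n<p (ℕD.∣⇒≤ p∣n)
... | inj₂ p∣n! = prime∤factorial p-prime (ℕP.<-trans (ℕP.n<1+n n) n<p) p∣n!

pos-*³ : ∀ x y z → + (x ℕ.* y ℕ.* z) ≡ + x * + y * + z
pos-*³ x y z = trans (ℤP.pos-* (x ℕ.* y) z) (cong (_* + z) (ℤP.pos-* x y))

cast-claim : ∀ k a b p s → + (k ℕ.* a ℕ.* b) - s * + (2 ℕ.* p) ≡ + k * + a * + b - s * (+ 2 * + p)
cast-claim k a b p s = cong₂ (λ x y → x - s * y) (pos-*³ k a b) (ℤP.pos-* 2 p)

factor-out : ∀ k a b p c → + b ≡ c * + p →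
  + (k ℕ.* a ℕ.* b) - -1ℤ * + (2 ℕ.* p) ≡ (+ k * + a * c + + 2) * + p
factor-out k a b p c b≡cp = begin
  + (k ℕ.* a ℕ.* b) - -1ℤ * + (2 ℕ.* p)       ≡⟨ cast-claim k a b p -1ℤ ⟩
  + k * + a * + b - -1ℤ * (+ 2 * + p)         ≡⟨ cong (λ x → + k * + a * x - -1ℤ * (+ 2 * + p)) b≡cp ⟩
  + k * + a * (c * + p) - -1ℤ * (+ 2 * + p)   ≡⟨ collect (+ k) (+ a) c (+ p) ⟩
  (+ k * + a * c + + 2) * + p                 ∎
  where
  open ≡-Reasoning
  collect : ∀ k a c p → k * a * (c * p) - -1ℤ * (+ 2 * p) ≡ (k * a * c + + 2) * p
  collect = solve-∀

exchange : ∀ k m P a b → k ℕ.+ m ≡ P →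
  + a * + b * + P - (+ (m ℕ.* b ℕ.* a) - -1ℤ * + (2 ℕ.* P)) ≡ + (k ℕ.* a ℕ.* b) - 1ℤ * + (2 ℕ.* P)
exchange k m .(k ℕ.+ m) a b refl = begin
  + a * + b * + P - (+ (m ℕ.* b ℕ.* a) - -1ℤ * + (2 ℕ.* P))
    ≡⟨ cong (λ y → + a * + b * + P - y) (cast-claim m b a P -1ℤ) ⟩
  + a * + b * + P - (+ m * + b * + a - -1ℤ * (+ 2 * + P))
    ≡⟨ cong (λ x → + a * + b * x - (+ m * + b * + a - -1ℤ * (+ 2 * x))) (ℤP.pos-+ k m) ⟩
  + a * + b * (+ k + + m) - (+ m * + b * + a - -1ℤ * (+ 2 * (+ k + + m)))
    ≡⟨ swap (+ k) (+ m) (+ a) (+ b) ⟩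
  + k * + a * + b - 1ℤ * (+ 2 * (+ k + + m))
    ≡⟨ cong (λ x → + k * + a * + b - 1ℤ * (+ 2 * x)) (ℤP.pos-+ k m) ⟨
  + k * + a * + b - 1ℤ * (+ 2 * + P)
    ≡⟨ cast-claim k a b P 1ℤ ⟨
  + (k ℕ.* a ℕ.* b) - 1ℤ * + (2 ℕ.* P)
    ∎
  where
  open ≡-Reasoning
  P = k ℕ.+ m
  swap : ∀ k m a b → a * b * (k + m) - (m * b * a - -1ℤ * (+ 2 * (k + m)))
       ≡ k * a * b - 1ℤ * (+ 2 * (k + m))
  swap = solve-∀

square-divides : ∀ {p y} → + p ∣ℤ y → + (p ℕ.* p) ∣ℤ y * + p
square-divides {p} {y} (divides d y≡dp) = divides d (begin
  y * + p             ≡⟨ cong (_* + p) y≡dp ⟩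
  d * + p * + p       ≡⟨ ℤP.*-assoc d (+ p) (+ p) ⟩
  d * (+ p * + p)     ≡⟨ cong (d *_) (ℤP.pos-* p p) ⟨
  d * + (p ℕ.* p)     ∎)
  where open ≡-Reasoning

module ModuloPrime (q : ℕ) (p-prime : Prime (suc q)) where
  open FactorialsModulo q
  open Congruence (+ p)

  euclid : ∀ x y → + p ∣ℤ x * y → + p ∣ℤ x ⊎ + p ∣ℤ y
  euclid x y p∣xy with euclidsLemma ℤ.∣ x ∣ ℤ.∣ y ∣ p-prime (subst (p ℕD.∣_) (ℤP.abs-* x y) (∣⇒∣ᵤ p∣xy))
  ... | inj₁ p∣x = inj₁ (ℤD.∣ᵤ⇒∣ p∣x)
  ... | inj₂ p∣y = inj₂ (ℤD.∣ᵤ⇒∣ p∣y)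

  ∤-product : ∀ {x y} → ¬ (+ p ∣ℤ x) → ¬ (+ p ∣ℤ y) → ¬ (+ p ∣ℤ x * y)
  ∤-product {x} {y} p∤x p∤y p∣xy with euclid x y p∣xy
  ... | inj₁ p∣x = p∤x p∣x
  ... | inj₂ p∣y = p∤y p∣y

  cancel : ∀ {x y} → ¬ (+ p ∣ℤ x) → + p ∣ℤ x * y → + p ∣ℤ y
  cancel {x} {y} p∤x p∣xy with euclid x y p∣xy
  ... | inj₁ p∣x = contradiction p∣x p∤x
  ... | inj₂ p∣y = p∣y

  ∤-fac : ∀ n → n < p → ¬ (+ p ∣ℤ fac n)
  ∤-fac n n<p p∣n! = prime∤factorial p-prime n<p (∣⇒∣ᵤ p∣n!)

  first<p : ∀ {x y} → x ℕ.+ y ≡ q → x < p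
  first<p {x} {y} x+y≡q = s≤s (subst (x ≤_) x+y≡q (ℕP.m≤m+n x y))

  second<p : ∀ {x y} → x ℕ.+ y ≡ q → y < p
  second<p {x} {y} x+y≡q = s≤s (subst (y ≤_) x+y≡q (ℕP.m≤n+m y x))

  divide-out : ∀ {x y Q} → ¬ (+ p ∣ℤ x) → x * y ≡ + p * Q → Σ ℤ λ c → y ≡ c * + p × c * x ≡ Q
  divide-out {x} {y} {Q} p∤x xy≡pQ with cancel p∤x (divides Q (trans xy≡pQ (ℤP.*-comm (+ p) Q)))
  ... | divides c y≡cp = c , y≡cp , ℤP.*-cancelˡ-≡ (+ p) (c * x) Q (begin
    + p * (c * x)   ≡⟨ regroup (+ p) c x ⟩
    x * (c * + p)   ≡⟨ cong (x *_) y≡cp ⟨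
    x * y           ≡⟨ xy≡pQ ⟩
    + p * Q         ∎)
    where
    open ≡-Reasoning
    regroup : ∀ p c x → p * (c * x) ≡ x * (c * p)
    regroup = solve-∀

  central-binomial-multiple : ∀ m r → 2 ℕ.* m ≡ p ℕ.+ r → m < p →
    Σ ℤ λ c → + ((2 ℕ.* m) C m) ≡ c * + p × c * (fac m * fac m) ≈ fac q * fac r
  central-binomial-multiple m r 2m≡p+r m<p =
    let (Q , [p+r]!≡pQ , Q≈) = beyond r
        (c , Cm≡cp , cM²≡Q) = divide-out {fac m * fac m} {+ ((2 ℕ.* m) C m)} {Q}
                                (∤-product (∤-fac m m<p) (∤-fac m m<p))
                                (trans (central-binomial m) (trans (cong fac 2m≡p+r) [p+r]!≡pQ))
    in c , Cm≡cp , ≈-trans (≡⇒≈ cM²≡Q) Q≈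

  cofactor-divisible : ∀ j r → j ℕ.+ (suc j ℕ.+ r) ≡ q → ∀ c →
    c * (fac (suc j ℕ.+ r) * fac (suc j ℕ.+ r)) ≈ fac q * fac r →
    + p ∣ℤ + suc j * + ((2 ℕ.* suc j) C suc j) * c + + 2
  cofactor-divisible j r j+m≡q c cM²≈WR = cancel p∤multiplier (≈0⇒∣ (annihilator (+ p)
    (+ suc j) (+ ((2 ℕ.* suc j) C suc j)) c (fac m) (fac j) (fac (suc j)) (fac (suc (j ℕ.+ j)))
    (fac q) (fac r) (fac-suc j) (central-binomial-step j) cM²≈WR
    (squared-reflection j m j+m≡q) (odd-reflection j r 2k-1+r≡q)))
    where
    m = suc j ℕ.+ r
    2k-1+r≡q : suc (j ℕ.+ j) ℕ.+ r ≡ q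
    2k-1+r≡q = trans (shuffle j r) j+m≡q
      where
      shuffle : ∀ j r → suc (j ℕ.+ j) ℕ.+ r ≡ j ℕ.+ (suc j ℕ.+ r)
      shuffle = ℕSolver.solve-∀
    p∤M : ¬ (+ p ∣ℤ fac m)
    p∤M = ∤-fac m (second<p j+m≡q)
    p∤multiplier : ¬ (+ p ∣ℤ fac m * fac m * fac j * fac (suc j) * fac (suc (j ℕ.+ j)))
    p∤multiplier = ∤-product (∤-product (∤-product (∤-product p∤M p∤M)
      (∤-fac j (first<p j+m≡q)))
      (∤-fac (suc j) (ℕP.≤-<-trans (ℕP.m≤m+n (suc j) r) (second<p j+m≡q))))
      (∤-fac (suc (j ℕ.+ j)) (first<p 2k-1+r≡q))

  below-half : ∀ k m → 1 ≤ k → k ≤ m → k ℕ.+ m ≡ p →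
    + (p ℕ.* p) ∣ℤ + (k ℕ.* ((2 ℕ.* k) C k) ℕ.* ((2 ℕ.* m) C m)) - -1ℤ * + (2 ℕ.* p)
  below-half (suc j) m _ k≤m k+m≡p with ℕP.m≤n⇒∃[o]m+o≡n k≤m
  ... | r , refl =
    let (c , Cm≡cp , cM²≈WR) = central-binomial-multiple m r 2m≡p+r (second<p j+m≡q)
    in subst (+ (p ℕ.* p) ∣ℤ_) (sym (factor-out (suc j) ((2 ℕ.* suc j) C suc j) ((2 ℕ.* m) C m) p c Cm≡cp))
         (square-divides (cofactor-divisible j r j+m≡q c cM²≈WR))
    where
    j+m≡q : j ℕ.+ m ≡ q
    j+m≡q = ℕP.suc-injective k+m≡p
    2m≡p+r : 2 ℕ.* m ≡ p ℕ.+ r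
    2m≡p+r = trans (doubling j r) (cong (ℕ._+ r) k+m≡p)
      where
      doubling : ∀ j r → 2 ℕ.* (suc j ℕ.+ r) ≡ suc j ℕ.+ (suc j ℕ.+ r) ℕ.+ r
      doubling = ℕSolver.solve-∀

  -- The "+" case: if k + m = p with 1 ≤ m ≤ k, then
  -- k·C(2k,k)·C(2m,m) ≡ 1·2p  (mod p²), since p ∣ C(2k,k) and the "−" case
  -- applies to m·C(2m,m)·C(2k,k).
  above-half : ∀ k m → 1 ≤ m → m ≤ k → k ℕ.+ m ≡ p →
    + (p ℕ.* p) ∣ℤ + (k ℕ.* ((2 ℕ.* k) C k) ℕ.* ((2 ℕ.* m) C m)) - 1ℤ * + (2 ℕ.* p)
  above-half k m 1≤m m≤k k+m≡p with ℕP.m≤n⇒∃[o]m+o≡n m≤k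
  ... | r , refl =
    let (c , Ck≡cp , _) = central-binomial-multiple k r 2k≡p+r k<p
        p∣CkCm = ℤD.∣m⇒∣m*n (+ ((2 ℕ.* m) C m)) (divides c Ck≡cp)
    in subst (+ (p ℕ.* p) ∣ℤ_) (exchange k m p ((2 ℕ.* k) C k) ((2 ℕ.* m) C m) k+m≡p)
         (ℤD.∣m∣n⇒∣m-n (square-divides p∣CkCm) (below-half m k 1≤m m≤k (trans (ℕP.+-comm m k) k+m≡p)))
    where
    k<p : k < p
    k<p = subst (k <_) k+m≡p (ℕP.m<m+n k 1≤m)
    2k≡p+r : 2 ℕ.* k ≡ p ℕ.+ r
    2k≡p+r = trans (doubling m r) (cong (ℕ._+ r) k+m≡p)
      where
      doubling : ∀ m r → 2 ℕ.* (m ℕ.+ r) ≡ m ℕ.+ r ℕ.+ m ℕ.+ r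
      doubling = ℕSolver.solve-∀

quotient-one : ∀ {x n} .{{_ : NonZero n}} → n ≤ x → x < 2 ℕ.* n → x / n ≡ 1
quotient-one {x} {n} n≤x x<2n = trans (m/n≡1+[m∸n]/n n≤x) (cong suc (m<n⇒m/n≡0 x∸n<n))
  where
  x∸n<n : x ∸ n < n
  x∸n<n = subst (x ∸ n <_) (double∸self n) (ℕP.∸-monoˡ-< x<2n n≤x)

smaller-part : ∀ {k p} → 2 ℕ.* k < p → k ≤ p ∸ k
smaller-part {k} {p} 2k<p = ℕP.m+n≤o⇒m≤o∸n k (subst (_≤ p) (cong (k ℕ.+_) (ℕP.+-identityʳ k)) (ℕP.<⇒≤ 2k<p))

larger-part : ∀ {k p} → p ≤ 2 ℕ.* k → p ∸ k ≤ k
larger-part {k} {p} p≤2k = ℕP.m≤n+o⇒m∸n≤o p k (subst (p ≤_) (cong (k ℕ.+_) (ℕP.+-identityʳ k)) p≤2k)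

open ModuloPrime using (below-half; above-half)

lemma2p1 : (p : ℕ) → .{{_ : NonZero p}} → Prime p → p ≢ 2 → (k : ℕ) → 1 ≤ k → k < p →
    (+ (p ℕ.* p)) ∣ ((+ (k ℕ.* ((2 ℕ.* k) C k) ℕ.* ((2 ℕ.* (p ∸ k)) C (p ∸ k))))
    - (negOnePow (+ ((2 ℕ.* k) / p) - + 1) ℤ.* + (2 ℕ.* p)))
lemma2p1 zero p-prime _ _ _ _ = contradiction p-prime ¬prime[0]
lemma2p1 p@(suc q) p-prime _ k 1≤k k<p with 2 ℕ.* k ℕ.<? p
... | yes 2k<p rewrite m<n⇒m/n≡0 2k<p =
  ∣⇒∣ᵤ (below-half q p-prime k (p ∸ k) 1≤k (smaller-part 2k<p) (ℕP.m+[n∸m]≡n (ℕP.<⇒≤ k<p)))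
... | no 2k≮p rewrite quotient-one (ℕP.≮⇒≥ 2k≮p) (ℕP.*-monoʳ-< 2 k<p) =
  ∣⇒∣ᵤ (above-half q p-prime k (p ∸ k) (ℕP.m<n⇒0<n∸m k<p) (larger-part (ℕP.≮⇒≥ 2k≮p))
                                        (ℕP.m+[n∸m]≡n (ℕP.<⇒≤ k<p)))
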